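{- Let $n \geqslant 3$ and let $k$ be an integer with $k \geqslant \lfloor n/2 \rfloor$ and $n \equiv k \pmod 2$. Let $f$ be a radio-$k$-labeling of $C_n$, with vertices ordered $x_0, \ldots, x_{n-1}$ so that $f(x_0) < \cdots < f(x_{n-1})$, and let $f_i = f(x_{i+1}) - f(x_i)$. If for some $i \in \{0, \ldots, n-3\}$ we have $f_i + f_{i+1} = \varPhi(n,k)$, where $\varPhi(n,k) = \left\lceil \frac{3k+3-n}{2} \right\rceil$, then $d(x_i, x_{i+2}) \in \left\{ \frac{n-k}{2}, \frac{n-k}{2} - 1 \right\}$.
   Context: $C_n$ is the cycle on vertex set $\mathbb{Z}_n$, with $u,v$ adjacent iff $u \equiv v \pm 1 \pmod n$; $d(u,v)$ is the graph distance. A radio-$k$-labeling of $C_n$ is a function $f \colon V(C_n) \to \{0,1,2,\ldots\}$ with $|f(u)-f(v)| \geqslant k - d(u,v) + 1$ for all distinct $u,v$; when $k \geqslant \lfloor n/2 \rfloor$ such $f$ is injective, so the increasing ordering $x_0,\ldots,x_{n-1}$ is well defined. -}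

module Defs where

open import Data.Nat.Base
open import Data.Fin.Base using (Fin; toℕ)
open import Data.Product using (_×_)
open import Function.Definitions using (Surjective)
open import Relation.Binary.PropositionalEquality using (_≡_)
open import Relation.Nullary using (¬_)

cycleDist : (n : ℕ) → Fin n → Fin n → ℕ
cycleDist n u v = ∣ toℕ u - toℕ v ∣ ⊓ (n ∸ ∣ toℕ u - toℕ v ∣)

-- Radio-k-labeling of C_n: |f(u) - f(v)| ≥ k - d(u,v) + 1 for distinct u, v.
-- (Truncated subtraction is harmless: if k - d + 1 ≤ 0 the condition is vacuous.)
IsRadioLabeling : (n k : ℕ) → (Fin n → ℕ) → Set
IsRadioLabeling n k f =
  ∀ (u v : Fin n) → ¬ (u ≡ v) → suc k ∸ cycleDist n u v ≤ ∣ f u - f v ∣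

IsIncreasingOrdering : (n : ℕ) → (Fin n → ℕ) → (Fin n → Fin n) → Set
IsIncreasingOrdering n f x =
  Surjective _≡_ _≡_ x ×
  (∀ (i j : Fin n) → toℕ i < toℕ j → f (x i) < f (x j))

Φ : ℕ → ℕ → ℕ
Φ n k = ⌈ (3 * k + 3 ∸ n) /2⌉

-- Put d₁ = d(x_i, x_{i+1}), d₂ = d(x_{i+1}, x_{i+2}) and d = d(x_i, x_{i+2}).
-- The radio condition gives f_i ≥ k + 1 − d₁, f_{i+1} ≥ k + 1 − d₂ and
-- f_i + f_{i+1} ≥ k + 1 − d, while any three vertices of C_n satisfy
-- d₁ + d₂ + d ≤ n.  With 2Φ ≤ 3k + 4 − n, the first two bounds and the
-- perimeter bound give k + 2d ≤ n, the third gives n ≤ k + 2d + 2, and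
-- since n ≡ k (mod 2) the difference n − k − 2d is 0 or 2.
module Submission where

open import Defs
open import Data.Nat.Base
open import Data.Nat.Properties
open import Data.Nat.DivMod using ([m+kn]%n≡m%n)
open import Data.Nat.Tactic.RingSolver using (solve-∀)
open import Data.Fin.Base using (Fin; toℕ)
open import Data.Fin.Properties using (toℕ<n)
open import Data.Product using (_×_; _,_; uncurry)
open import Data.Sum using (_⊎_; inj₁; inj₂)
open import Relation.Binary.PropositionalEquality
  using (_≡_; _≢_; refl; sym; trans; cong; subst; module ≡-Reasoning)
open import Relation.Nullary using (contradiction)

cycleDistℕ : ℕ → ℕ → ℕ → ℕ
cycleDistℕ n a b = ∣ a - b ∣ ⊓ (n ∸ ∣ a - b ∣)

cycleDistℕ-comm : ∀ n a b → cycleDistℕ n a b ≡ cycleDistℕ n b a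
cycleDistℕ-comm n a b rewrite ∣-∣-comm a b = refl

perimeter : ℕ → ℕ → ℕ → ℕ → ℕ
perimeter n a b c = cycleDistℕ n a b + cycleDistℕ n b c + cycleDistℕ n a c

perimeter-swapˡ : ∀ n a b c → perimeter n a b c ≡ perimeter n b a c
perimeter-swapˡ n a b c rewrite cycleDistℕ-comm n a b =
  swap (cycleDistℕ n b a) (cycleDistℕ n b c) (cycleDistℕ n a c)
  where
  swap : ∀ x y z → x + y + z ≡ x + z + y
  swap = solve-∀

perimeter-swapʳ : ∀ n a b c → perimeter n a b c ≡ perimeter n a c b
perimeter-swapʳ n a b c rewrite cycleDistℕ-comm n b c =
  reverse (cycleDistℕ n a b) (cycleDistℕ n c b) (cycleDistℕ n a c)
  where
  reverse : ∀ x y z → x + y + z ≡ z + y + x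
  reverse = solve-∀

∸-split : ∀ {a b c} → a ≤ b → b ≤ c → (b ∸ a) + (c ∸ b) ≡ c ∸ a
∸-split {a} {b} {c} a≤b b≤c = begin
  (b ∸ a) + (c ∸ b)  ≡⟨ +-∸-comm (c ∸ b) a≤b ⟨
  (b + (c ∸ b)) ∸ a  ≡⟨ cong (_∸ a) (m+[n∸m]≡n b≤c) ⟩
  c ∸ a              ∎
  where open ≡-Reasoning

-- Two sides are bounded by the arcs between neighbours, the third by the
-- complementary arc; together the arcs make up the whole cycle.
perimeter-sorted : ∀ {n a b c} → a ≤ b → b ≤ c → c ≤ n → perimeter n a b c ≤ n
perimeter-sorted {n} {a} {b} {c} a≤b b≤c c≤n = begin
  perimeter n a b c
    ≤⟨ +-mono-≤ (+-mono-≤ (m⊓n≤m ∣ a - b ∣ _) (m⊓n≤m ∣ b - c ∣ _)) (m⊓n≤n ∣ a - c ∣ _) ⟩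
  ∣ a - b ∣ + ∣ b - c ∣ + (n ∸ ∣ a - c ∣)
    ≡⟨ cong₃ (m≤n⇒∣m-n∣≡n∸m a≤b) (m≤n⇒∣m-n∣≡n∸m b≤c) (m≤n⇒∣m-n∣≡n∸m a≤c) ⟩
  (b ∸ a) + (c ∸ b) + (n ∸ (c ∸ a))
    ≡⟨ cong (_+ (n ∸ (c ∸ a))) (∸-split a≤b b≤c) ⟩
  (c ∸ a) + (n ∸ (c ∸ a))
    ≡⟨ m+[n∸m]≡n (≤-trans (m∸n≤m c a) c≤n) ⟩
  n ∎
  where
  open ≤-Reasoning
  a≤c : a ≤ c
  a≤c = ≤-trans a≤b b≤c
  cong₃ : ∀ {x x′ y y′ z z′} → x ≡ x′ → y ≡ y′ → z ≡ z′ →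
          x + y + (n ∸ z) ≡ x′ + y′ + (n ∸ z′)
  cong₃ refl refl refl = refl

perimeter-≤-from-min : ∀ {n a b c} → a ≤ b → a ≤ c → b ≤ n → c ≤ n →
                       perimeter n a b c ≤ n
perimeter-≤-from-min {n} {a} {b} {c} a≤b a≤c b≤n c≤n with ≤-total b c
... | inj₁ b≤c = perimeter-sorted a≤b b≤c c≤n
... | inj₂ c≤b = subst (_≤ n) (perimeter-swapʳ n a c b) (perimeter-sorted a≤c c≤b b≤n)

perimeter-≤-from-minʳ : ∀ {n a b c} → c ≤ a → c ≤ b → a ≤ n → b ≤ n →
                        perimeter n a b c ≤ n
perimeter-≤-from-minʳ {n} {a} {b} {c} c≤a c≤b a≤n b≤n =
  subst (_≤ n) (trans (perimeter-swapˡ n c a b) (perimeter-swapʳ n a c b))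
    (perimeter-≤-from-min c≤a c≤b a≤n b≤n)

perimeter-≤ : ∀ {n a b c} → a ≤ n → b ≤ n → c ≤ n → perimeter n a b c ≤ n
perimeter-≤ {n} {a} {b} {c} a≤n b≤n c≤n with ≤-total a b | ≤-total a c | ≤-total b c
... | inj₁ a≤b | inj₁ a≤c | _        = perimeter-≤-from-min a≤b a≤c b≤n c≤n
... | inj₂ b≤a | _        | inj₁ b≤c =
  subst (_≤ n) (perimeter-swapˡ n b a c) (perimeter-≤-from-min b≤a b≤c a≤n c≤n)
... | inj₁ a≤b | inj₂ c≤a | _        = perimeter-≤-from-minʳ c≤a (≤-trans c≤a a≤b) a≤n b≤n
... | inj₂ b≤a | _        | inj₂ c≤b = perimeter-≤-from-minʳ (≤-trans c≤b b≤a) c≤b a≤n b≤n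

radio-gap : ∀ {n k} (f : Fin n → ℕ) → IsRadioLabeling n k f → ∀ u v → f u < f v →
            suc k ≤ cycleDist n u v + (f v ∸ f u)
radio-gap {n} {k} f radio u v fu<fv = begin
  suc k                                  ≤⟨ m≤n+m∸n (suc k) (cycleDist n u v) ⟩
  cycleDist n u v + (suc k ∸ cycleDist n u v)
    ≤⟨ +-monoʳ-≤ (cycleDist n u v) (radio u v (λ u≡v → <-irrefl (cong f u≡v) fu<fv)) ⟩
  cycleDist n u v + ∣ f u - f v ∣        ≡⟨ cong (cycleDist n u v +_) (m≤n⇒∣m-n∣≡n∸m (<⇒≤ fu<fv)) ⟩
  cycleDist n u v + (f v ∸ f u)          ∎
  where open ≤-Reasoning

⌈n/2⌉≤1+⌊n/2⌋ : ∀ n → ⌈ n /2⌉ ≤ suc ⌊ n /2⌋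
⌈n/2⌉≤1+⌊n/2⌋ zero          = z≤n
⌈n/2⌉≤1+⌊n/2⌋ (suc zero)    = s≤s z≤n
⌈n/2⌉≤1+⌊n/2⌋ (suc (suc n)) = s≤s (⌈n/2⌉≤1+⌊n/2⌋ n)

⌈n/2⌉+⌈n/2⌉≤1+n : ∀ n → ⌈ n /2⌉ + ⌈ n /2⌉ ≤ suc n
⌈n/2⌉+⌈n/2⌉≤1+n n = begin
  ⌈ n /2⌉ + ⌈ n /2⌉         ≤⟨ +-monoʳ-≤ ⌈ n /2⌉ (⌊n/2⌋≤⌈n/2⌉ (suc n)) ⟩
  ⌊ suc n /2⌋ + ⌈ suc n /2⌉ ≡⟨ ⌊n/2⌋+⌈n/2⌉≡n (suc n) ⟩
  suc n                     ∎
  where open ≤-Reasoning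

n≤1+2⌊n/2⌋ : ∀ n → n ≤ suc (⌊ n /2⌋ + ⌊ n /2⌋)
n≤1+2⌊n/2⌋ n = begin
  n                         ≡⟨ ⌊n/2⌋+⌈n/2⌉≡n n ⟨
  ⌊ n /2⌋ + ⌈ n /2⌉         ≤⟨ +-monoʳ-≤ ⌊ n /2⌋ (⌈n/2⌉≤1+⌊n/2⌋ n) ⟩
  ⌊ n /2⌋ + suc ⌊ n /2⌋     ≡⟨ +-suc ⌊ n /2⌋ ⌊ n /2⌋ ⟩
  suc (⌊ n /2⌋ + ⌊ n /2⌋)   ∎
  where open ≤-Reasoning

-- ⌊n/2⌋ ≤ k gives n ≤ 3k + 3, so the truncated subtraction inside Φ is exact.
Φ+Φ+n≤3k+4 : ∀ {n k} → ⌊ n /2⌋ ≤ k → Φ n k + Φ n k + n ≤ 3 * k + 4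
Φ+Φ+n≤3k+4 {n} {k} ⌊n/2⌋≤k = begin
  Φ n k + Φ n k + n             ≤⟨ +-monoˡ-≤ n (⌈n/2⌉+⌈n/2⌉≤1+n (3 * k + 3 ∸ n)) ⟩
  suc (3 * k + 3 ∸ n) + n       ≡⟨ cong suc (m∸n+n≡m n≤3k+3) ⟩
  suc (3 * k + 3)               ≡⟨ +-suc (3 * k) 3 ⟨
  3 * k + 4                     ∎
  where
  open ≤-Reasoning
  n≤3k+3 : n ≤ 3 * k + 3
  n≤3k+3 = begin
    n                        ≤⟨ n≤1+2⌊n/2⌋ n ⟩
    suc (⌊ n /2⌋ + ⌊ n /2⌋)  ≤⟨ s≤s (+-mono-≤ ⌊n/2⌋≤k ⌊n/2⌋≤k) ⟩
    suc (k + k)              ≤⟨ m≤m+n (suc (k + k)) (k + 2) ⟩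
    suc (k + k) + (k + 2)    ≡⟨ identity k ⟩
    3 * k + 3                ∎
    where
    identity : ∀ k → suc (k + k) + (k + 2) ≡ 3 * k + 3
    identity = solve-∀

distance-window : ∀ {n k P₁ P₂ d₁ d₂ d} → (P₁ + P₂) + (P₁ + P₂) + n ≤ 3 * k + 4 →
                  suc k ≤ d₁ + P₁ → suc k ≤ d₂ + P₂ → d₁ + d₂ + d ≤ n →
                  suc k ≤ d + (P₁ + P₂) →
                  2 * d + k ≤ n × n ≤ 2 * d + k + 2
distance-window {n} {k} {P₁} {P₂} {d₁} {d₂} {d} Φ-bound gap₁ gap₂ perimeter-bound gap =
    +-cancelˡ-≤ (3 * k + 4) (2 * d + k) n lower
  , +-cancelˡ-≤ (suc k + suc k) n (2 * d + k + 2) upper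
  where
  open ≤-Reasoning
  P : ℕ
  P = P₁ + P₂
  two-gaps : suc k + suc k + d ≤ n + P
  two-gaps = begin
    suc k + suc k + d           ≤⟨ +-monoˡ-≤ d (+-mono-≤ gap₁ gap₂) ⟩
    (d₁ + P₁) + (d₂ + P₂) + d   ≡⟨ e d₁ d₂ d P₁ P₂ ⟩
    (d₁ + d₂ + d) + P           ≤⟨ +-monoˡ-≤ P perimeter-bound ⟩
    n + P                       ∎
    where
    e : ∀ d₁ d₂ d P₁ P₂ → (d₁ + P₁) + (d₂ + P₂) + d ≡ (d₁ + d₂ + d) + (P₁ + P₂)
    e = solve-∀
  lower : 3 * k + 4 + (2 * d + k) ≤ 3 * k + 4 + n
  lower = begin
    3 * k + 4 + (2 * d + k)                   ≡⟨ e₁ k d ⟩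
    (suc k + suc k + d) + (suc k + suc k + d) ≤⟨ +-mono-≤ two-gaps two-gaps ⟩
    (n + P) + (n + P)                         ≡⟨ e₂ n P ⟩
    P + P + n + n                             ≤⟨ +-monoˡ-≤ n Φ-bound ⟩
    3 * k + 4 + n                             ∎
    where
    e₁ : ∀ k d → 3 * k + 4 + (2 * d + k) ≡ (suc k + suc k + d) + (suc k + suc k + d)
    e₁ = solve-∀
    e₂ : ∀ n P → (n + P) + (n + P) ≡ P + P + n + n
    e₂ = solve-∀
  upper : suc k + suc k + n ≤ suc k + suc k + (2 * d + k + 2)
  upper = begin
    suc k + suc k + n                ≤⟨ +-monoˡ-≤ n (+-mono-≤ gap gap) ⟩
    (d + P) + (d + P) + n            ≡⟨ e₁ d P n ⟩
    d + d + (P + P + n)              ≤⟨ +-monoʳ-≤ (d + d) Φ-bound ⟩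
    d + d + (3 * k + 4)              ≡⟨ e₂ d k ⟩
    suc k + suc k + (2 * d + k + 2)  ∎
    where
    e₁ : ∀ d P n → (d + P) + (d + P) + n ≡ d + d + (P + P + n)
    e₁ = solve-∀
    e₂ : ∀ d k → d + d + (3 * k + 4) ≡ suc k + suc k + (2 * d + k + 2)
    e₂ = solve-∀

[1+m]%2≢m%2 : ∀ m → suc m % 2 ≢ m % 2
[1+m]%2≢m%2 zero          = λ ()
[1+m]%2≢m%2 (suc zero)    = λ ()
[1+m]%2≢m%2 (suc (suc m)) = [1+m]%2≢m%2 m

same-parity-squeeze : ∀ {m n} → m % 2 ≡ n % 2 → m ≤ n → n ≤ m + 2 → m ≡ n ⊎ m + 2 ≡ n
same-parity-squeeze {m} m≡n[mod2] m≤n n≤m+2 with m≤n⇒∃[o]m+o≡n m≤n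
... | 0 , refl = inj₁ (sym (+-identityʳ m))
... | 1 , refl = contradiction (trans (cong (_% 2) (+-comm 1 m)) (sym m≡n[mod2])) ([1+m]%2≢m%2 m)
... | 2 , refl = inj₂ refl
... | suc (suc (suc e)) , refl =
  contradiction (+-cancelˡ-≤ m (3 + e) 2 n≤m+2) λ { (s≤s (s≤s ())) }

[2d+k]%2≡k%2 : ∀ d k → (2 * d + k) % 2 ≡ k % 2
[2d+k]%2≡k%2 d k = trans (cong (_% 2) (e d k)) ([m+kn]%n≡m%n k d 2)
  where
  e : ∀ d k → 2 * d + k ≡ k + d * 2
  e = solve-∀

lemma3p3 : (n k : ℕ) → 3 ≤ n → ⌊ n /2⌋ ≤ k → n % 2 ≡ k % 2 →
    (f : Fin n → ℕ) → IsRadioLabeling n k f →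
    (x : Fin n → Fin n) → IsIncreasingOrdering n f x →
    (a b c : Fin n) → toℕ b ≡ suc (toℕ a) → toℕ c ≡ suc (toℕ b) →
    (f (x b) ∸ f (x a)) + (f (x c) ∸ f (x b)) ≡ Φ n k →
    (2 * cycleDist n (x a) (x c) + k ≡ n) ⊎ (2 * cycleDist n (x a) (x c) + k + 2 ≡ n)
lemma3p3 n k _ ⌊n/2⌋≤k n≡k[mod2] f radio x (_ , increasing) a b c b≡1+a c≡1+b fᵢ+fᵢ₊₁≡Φ =
  uncurry (same-parity-squeeze (trans ([2d+k]%2≡k%2 d k) (sym n≡k[mod2]))) window
  where
  fᵢ fᵢ₊₁ d₁ d₂ d : ℕ
  fᵢ   = f (x b) ∸ f (x a)
  fᵢ₊₁ = f (x c) ∸ f (x b)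
  d₁   = cycleDist n (x a) (x b)
  d₂   = cycleDist n (x b) (x c)
  d    = cycleDist n (x a) (x c)
  fa<fb : f (x a) < f (x b)
  fa<fb = increasing a b (≤-reflexive (sym b≡1+a))
  fb<fc : f (x b) < f (x c)
  fb<fc = increasing b c (≤-reflexive (sym c≡1+b))
  Φ-bound : (fᵢ + fᵢ₊₁) + (fᵢ + fᵢ₊₁) + n ≤ 3 * k + 4
  Φ-bound = subst (λ P → P + P + n ≤ 3 * k + 4) (sym fᵢ+fᵢ₊₁≡Φ) (Φ+Φ+n≤3k+4 ⌊n/2⌋≤k)
  gapₐᵦ : suc k ≤ d₁ + fᵢ
  gapₐᵦ = radio-gap f radio (x a) (x b) fa<fb
  gapᵦ꜀ : suc k ≤ d₂ + fᵢ₊₁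
  gapᵦ꜀ = radio-gap f radio (x b) (x c) fb<fc
  gapₐ꜀ : suc k ≤ d + (fᵢ + fᵢ₊₁)
  gapₐ꜀ = subst (λ P → suc k ≤ d + P) (sym (∸-split (<⇒≤ fa<fb) (<⇒≤ fb<fc)))
          (radio-gap f radio (x a) (x c) (<-trans fa<fb fb<fc))
  perimeter-bound : d₁ + d₂ + d ≤ n
  perimeter-bound = perimeter-≤ (position≤n a) (position≤n b) (position≤n c)
    where
    position≤n : ∀ i → toℕ (x i) ≤ n
    position≤n i = <⇒≤ (toℕ<n (x i))
  window : 2 * d + k ≤ n × n ≤ 2 * d + k + 2
  window = distance-window {P₁ = fᵢ} {fᵢ₊₁} {d₁} {d₂} {d} Φ-bound gapₐᵦ gapᵦ꜀ perimeter-bound gapₐ꜀
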